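{- Let $\mathcal{P}=(Q,T)$ be a replicated system and $U\subseteq T$. For every $k\ge1$ there is an existential Presburger formula $\mathit{DeathCert}_k(U,\mathcal{C}^\omega)$, whose free variables represent the components of $k$ $\omega$-configurations $C^\omega_1,\dots,C^\omega_k$, that holds if and only if $\mathcal{C}^\omega=\{C^\omega_1,\dots,C^\omega_k\}$ is a death certificate of size $k$ for $U$.
   Context: A replicated system of arity $n$ over a finite set $Q$ is a pair $\mathcal{P}=(Q,T)$ with $T\subseteq\bigcup_{k=0}^n Q^{(k)}\times Q^{(k)}$ ($Q^{(k)}$ = multisets over $Q$ of size $k$), containing every silent pair $(x,x)$, $x\in Q^{(k)}$, $k\le n$. Configurations are multisets $C\in\mathbb{N}^Q$. For $t=(x,y)\in T$, $t$ is enabled at $C$ if $C\ge x$ componentwise (otherwise disabled), and then $C\xrightarrow{t}C-x+y$. An $\omega$-configuration is a map $Q\to\mathbb{N}\cup\{\omega\}$ (with $m<\omega$ and $\omega+m=\omega$ for $m\in\mathbb{Z}$); for a finite set $\mathcal{C}^\omega$ of $\omega$-configurations, $\downarrow\mathcal{C}^\omega=\{C\in\mathbb{N}^Q: C\le C^\omega$ for some $C^\omega\in\mathcal{C}^\omega\}$. A set $\mathcal{C}$ is inductive if $C\in\mathcal{C}$, $C\xrightarrow{t}C'$ imply $C'\in\mathcal{C}$. A death certificate for $U$ is a finite set $\mathcal{C}^\omega$ of $\omega$-configurations such that (1) every configuration of $\downarrow\mathcal{C}^\omega$ disables all transitions of $U$, and (2) $\downarrow\mathcal{C}^\omega$ is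 inductive. Its size is its cardinality. An existential Presburger formula is one of the form $\exists\mathbf{y}\,\psi$ with $\psi$ a quantifier-free Boolean combination of linear constraints and congruences with integer coefficients. -}

module Defs where

open import Data.Nat as ℕ using (ℕ; zero; suc; _+_; _∸_)
open import Data.Integer as ℤ using (ℤ; +_)
open import Data.Integer.Divisibility as ℤD using ()
open import Data.Fin using (Fin)
open import Data.Vec using (Vec; []; _∷_; lookup; zipWith; map; concat; _++_)
open import Data.Vec.Relation.Binary.Pointwise.Inductive using (Pointwise)
open import Data.List using (List)
open import Data.List.Membership.Propositional using (_∈_)
open import Data.List.Relation.Unary.All using (All)
open import Data.Product using (Σ; ∃; _×_; _,_)
open import Data.Sum using (_⊎_)
open import Data.Empty using (⊥)
open import Data.Unit using (⊤)
open import Relation.Nullary using (¬_)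
open import Relation.Binary.PropositionalEquality using (_≡_)

-- Configurations / multisets over Q = Fin m
Config : ℕ → Set
Config m = Vec ℕ m

size : ∀ {m} → Config m → ℕ
size []       = 0
size (a ∷ xs) = a + size xs

_≤ᶜ_ : ∀ {m} → Config m → Config m → Set
C ≤ᶜ D = Pointwise ℕ._≤_ C D

Transition : ℕ → Set
Transition m = Config m × Config m

pre : ∀ {m} → Transition m → Config m
pre (x , y) = x

post : ∀ {m} → Transition m → Config m
post (x , y) = y

-- replicated system of arity n over Q = Fin m; the finite set T is a list
record ReplicatedSystem (m n : ℕ) : Set where
  field
    T          : List (Transition m)
    T-arity    : All (λ t → size (pre t) ≡ size (post t) × size (pre t) ℕ.≤ n) T
    T-silent   : ∀ (x : Config m) → size x ℕ.≤ n → (x , x) ∈ T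
open ReplicatedSystem public

Enabled : ∀ {m} → Transition m → Config m → Set
Enabled t C = pre t ≤ᶜ C

Disabled : ∀ {m} → Transition m → Config m → Set
Disabled t C = ¬ Enabled t C

Fires : ∀ {m} → Config m → Transition m → Config m → Set
Fires C t C' = Enabled t C × C' ≡ zipWith _+_ (zipWith _∸_ C (pre t)) (post t)

Step : ∀ {m n} → ReplicatedSystem m n → Config m → Config m → Set
Step P C C' = Σ (Transition _) λ t → t ∈ T P × Fires C t C'

data ℕω : Set where
  fin : ℕ → ℕω
  ω   : ℕω

_≤ω_ : ℕ → ℕω → Set
a ≤ω fin b = a ℕ.≤ b
a ≤ω ω     = ⊤

ωConfig : ℕ → Set
ωConfig m = Vec ℕω m

_≤ᶜω_ : ∀ {m} → Config m → ωConfig m → Set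
C ≤ᶜω Cω = Pointwise _≤ω_ C Cω

Down : ∀ {m k} → Vec (ωConfig m) k → Config m → Set
Down {k = k} Cs C = Σ (Fin k) λ i → C ≤ᶜω lookup Cs i

Inductive : ∀ {m n} → ReplicatedSystem m n → (Config m → Set) → Set
Inductive P S = ∀ C C' → S C → Step P C C' → S C'

IsDeathCertificate : ∀ {m n k} → ReplicatedSystem m n → List (Transition m) →
                     Vec (ωConfig m) k → Set
IsDeathCertificate P U Cs =
  (∀ C → Down Cs C → ∀ t → t ∈ U → Disabled t C) × Inductive P (Down Cs)

-- the set {C₁,…,C_k} has cardinality exactly k
Distinct : ∀ {A : Set} {k} → Vec A k → Set
Distinct {k = k} xs = ∀ (i j : Fin k) → lookup xs i ≡ lookup xs j → i ≡ j

LinTerm : ℕ → Set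
LinTerm v = Vec ℤ v

data QF (v : ℕ) : Set where
  leq  : LinTerm v → ℤ → QF v
  cong : LinTerm v → ℤ → ℕ → QF v
  not  : QF v → QF v
  and  : QF v → QF v → QF v
  or   : QF v → QF v → QF v

evalLin : ∀ {v} → LinTerm v → Vec ℕ v → ℤ
evalLin []       []       = + 0
evalLin (a ∷ as) (x ∷ xs) = a ℤ.* (+ x) ℤ.+ evalLin as xs

⟦_⟧qf : ∀ {v} → QF v → Vec ℕ v → Set
⟦ leq a b ⟧qf    ρ = evalLin a ρ ℤ.≤ b
⟦ cong a b c ⟧qf ρ = (+ c) ℤD.∣ (evalLin a ρ ℤ.- b)
⟦ not φ ⟧qf      ρ = ¬ ⟦ φ ⟧qf ρ
⟦ and φ ψ ⟧qf    ρ = ⟦ φ ⟧qf ρ × ⟦ ψ ⟧qf ρ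
⟦ or φ ψ ⟧qf     ρ = ⟦ φ ⟧qf ρ ⊎ ⟦ ψ ⟧qf ρ

record ExPresburger (v : ℕ) : Set where
  constructor ∃[_]_
  field
    nbound : ℕ
    body   : QF (nbound + v)

⟦_⟧ : ∀ {v} → ExPresburger v → Vec ℕ v → Set
⟦ ∃[ e ] ψ ⟧ ρ = Σ (Vec ℕ e) λ ys → ⟦ ψ ⟧qf (ys ++ ρ)

encodeω : ℕω → ℕ
encodeω ω       = 0
encodeω (fin a) = suc a

encode : ∀ {m k} → Vec (ωConfig m) k → Vec ℕ (k ℕ.* m)
encode Cs = concat (map (map encodeω) Cs)

-- For ω-configurations C₁ … C_k,
--   * every configuration of ↓{Cᵢ} disables U  iff  no pre-multiset of a
--     transition of U lies below any Cᵢ, and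
--   * ↓{Cᵢ} is inductive  iff  whenever t ∈ T is enabled at Cᵢ, the ω-configuration
--     Cᵢ - pre t + post t (with ω - p + s = ω) lies below some C_j.
--   The only non-trivial direction is the last "only if": firing t from the
--   configuration obtained from Cᵢ by replacing each ω with a number larger than
--   every finite entry of the certificate forces the ω-entries of the target to
--   be ω as well.
--
-- Encoding ω as 0 and a as a + 1, every condition of (1)
--   is a finite Boolean combination of constraints  x + s ≤ y + p  between
--   variables and constants, so the conjunction of "distinct", "disables U" and
--   "inductive" is a quantifier-free Presburger formula.

module Submission where

open import Defs
open import Data.Nat using (ℕ; _≤_; _*_)
open import Data.Vec using (Vec)
open import Data.List using (List)
open import Data.List.Membership.Propositional using (_∈_)
open import Data.List.Relation.Unary.All using (All)
open import Data.Product using (Σ; _×_)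
open import Function.Bundles using (_⇔_)

open import Data.Nat as ℕ using (zero; suc; _+_; _∸_; _<_; z≤n; s≤s)
import Data.Nat.Properties as ℕP
open import Data.Integer as ℤ using (ℤ; +_; -_)
import Data.Integer.Properties as ℤP
open import Data.Integer.Tactic.RingSolver using (solve-∀)
open import Data.Fin as F using (Fin)
open import Data.Vec as V using ([]; _∷_; lookup; zipWith; tabulate)
import Data.Vec.Properties as VP
import Data.Vec.Relation.Binary.Pointwise.Inductive as PW
import Data.Vec.Relation.Binary.Pointwise.Extensional as PWₑ
open import Data.Vec.Relation.Binary.Pointwise.Inductive using (Pointwise)
open import Data.List using ([]; _∷_; allFin)
open import Data.List.Relation.Unary.Any using (here; there)
open import Data.List.Membership.Propositional.Properties using (∈-allFin)
open import Data.Product using (_,_; ∃; proj₁; proj₂)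
open import Data.Product.Function.NonDependent.Propositional using (_×-⇔_)
open import Data.Sum using (_⊎_; inj₁; inj₂)
open import Data.Sum.Function.Propositional using (_⊎-⇔_)
open import Data.Empty using (⊥-elim)
open import Data.Unit using (⊤; tt)
open import Relation.Nullary using (¬_; Dec; yes; no)
open import Relation.Binary.PropositionalEquality
  using (_≡_; refl; subst; subst₂; module ≡-Reasoning) renaming (cong to ≡-cong; sym to ≡-sym; trans to ≡-trans)
open import Function.Bundles using (mk⇔; Equivalence)
import Function.Properties.Equivalence as ⇔
open import Function.Related.TypeIsomorphisms using (¬-cong-⇔)

open Equivalence using (to; from)

pointwise⇔ : ∀ {A B : Set} {R : A → B → Set} {j} {xs : Vec A j} {ys : Vec B j} →
  Pointwise R xs ys ⇔ (∀ i → R (lookup xs i) (lookup ys i))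
pointwise⇔ = mk⇔ PW.lookup (λ h → PWₑ.extensional⇒inductive (PWₑ.ext h))

lookup-fire : ∀ {m} (C x y : Config m) q →
  lookup (zipWith _+_ (zipWith _∸_ C x) y) q ≡ lookup C q ∸ lookup x q + lookup y q
lookup-fire C x y q rewrite VP.lookup-zipWith _+_ q (zipWith _∸_ C x) y
                          | VP.lookup-zipWith _∸_ q C x = refl

≤-≤ω-trans : ∀ {a b u} → a ≤ b → b ≤ω u → a ≤ω u
≤-≤ω-trans {u = fin _} a≤b b≤u = ℕP.≤-trans a≤b b≤u
≤-≤ω-trans {u = ω}     _   _   = tt

-- Enabledness at an ω-configuration is decidable (needed to read the closure
-- formula as an implication).
_≤ω?_ : ∀ a u → Dec (a ≤ω u)
a ≤ω? fin b = a ℕ.≤? b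
a ≤ω? ω     = yes tt

_⊑_ : ℕω → ℕω → Set
fin a ⊑ w = a ≤ω w
ω     ⊑ w = w ≡ ω

shiftω : ℕω → ℕ → ℕ → ℕω
shiftω (fin a) p s = fin (a ∸ p + s)
shiftω ω       p s = ω

≤ω-shift : ∀ {c u w} p s → c ≤ω u → shiftω u p s ⊑ w → (c ∸ p + s) ≤ω w
≤ω-shift {u = fin a} p s c≤a below =
  ≤-≤ω-trans (ℕP.+-monoˡ-≤ s (ℕP.∸-monoˡ-≤ p c≤a)) below
≤ω-shift {u = ω} p s _ refl = tt

_≺_ : ℕω → ℕ → Set
fin a ≺ N = a < N
ω     ≺ N = ⊤

≺-mono : ∀ {u : ℕω} {M N : ℕ} → u ≺ M → M ≤ N → u ≺ N
≺-mono {fin _} u<M M≤N = ℕP.<-≤-trans u<M M≤N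
≺-mono {ω}     _   _   = tt

sumFin : ∀ {j} → Vec ℕω j → ℕ
sumFin []          = 0
sumFin (fin a ∷ v) = a + sumFin v
sumFin (ω ∷ v)     = sumFin v

sumFin-bounds : ∀ {j} (v : Vec ℕω j) q → lookup v q ≺ suc (sumFin v)
sumFin-bounds (fin a ∷ v) F.zero    = s≤s (ℕP.m≤m+n a (sumFin v))
sumFin-bounds (ω ∷ v)     F.zero    = tt
sumFin-bounds (fin a ∷ v) (F.suc q) = ≺-mono (sumFin-bounds v q) (s≤s (ℕP.m≤n+m (sumFin v) a))
sumFin-bounds (ω ∷ v)     (F.suc q) = sumFin-bounds v q

StepsBelow : ∀ {m} → ωConfig m → Transition m → ωConfig m → Set
StepsBelow Cω t Dω =
  ∀ q → shiftω (lookup Cω q) (lookup (pre t) q) (lookup (post t) q) ⊑ lookup Dω q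

≤ᶜ-≤ᶜω-trans : ∀ {m} {C D : Config m} {Cω : ωConfig m} → C ≤ᶜ D → D ≤ᶜω Cω → C ≤ᶜω Cω
≤ᶜ-≤ᶜω-trans = PW.trans ≤-≤ω-trans

-- ↓{Cᵢ} disables the transitions of U iff no Cᵢ enables one of them; the
-- witness for "only if" is the pre-multiset of the transition itself.
disables⇔ : ∀ {m k} (Cs : Vec (ωConfig m) k) (U : List (Transition m)) →
  (∀ C → Down Cs C → ∀ t → t ∈ U → Disabled t C) ⇔
  (∀ i t → t ∈ U → ¬ (pre t ≤ᶜω lookup Cs i))
disables⇔ Cs U = mk⇔
  (λ dis i t t∈U en → dis (pre t) (i , en) t t∈U (PW.refl ℕP.≤-refl))
  (λ dis C (i , C≤Cᵢ) t t∈U en → dis i t t∈U (≤ᶜ-≤ᶜω-trans en C≤Cᵢ))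

inductive-from-steps : ∀ {m n k} (P : ReplicatedSystem m n) (Cs : Vec (ωConfig m) k) →
  (∀ i t → t ∈ T P → pre t ≤ᶜω lookup Cs i → ∃ λ j → StepsBelow (lookup Cs i) t (lookup Cs j)) →
  Inductive P (Down Cs)
inductive-from-steps P Cs steps C C′ (i , C≤Cᵢ) (t , t∈T , en , refl)
  with steps i t t∈T (≤ᶜ-≤ᶜω-trans en C≤Cᵢ)
... | j , below = j , from pointwise⇔ λ q →
  subst (_≤ω lookup (lookup Cs j) q) (≡-sym (lookup-fire C (pre t) (post t) q))
    (≤ω-shift (lookup (pre t) q) (lookup (post t) q) (PW.lookup C≤Cᵢ q) (below q))

witnessAt : ℕ → ℕω → ℕ → ℕ
witnessAt N (fin a) p = a
witnessAt N ω       p = N + p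

witness : ∀ {m} → ℕ → ωConfig m → Config m → Config m
witness N Cω x = tabulate λ q → witnessAt N (lookup Cω q) (lookup x q)

witnessAt-below : ∀ N u p → witnessAt N u p ≤ω u
witnessAt-below N (fin a) p = ℕP.≤-refl
witnessAt-below N ω       p = tt

witnessAt-enables : ∀ N u p → p ≤ω u → p ≤ witnessAt N u p
witnessAt-enables N (fin a) p p≤a = p≤a
witnessAt-enables N ω       p _   = ℕP.m≤n+m p N

-- If N bounds the finite part of w, then firing from the witness lands below w
-- only if firing from u does: an ω-entry of u becomes N + s, which fits below w
-- only when w is ω.
witnessAt-steps : ∀ N p s u w → w ≺ N → (witnessAt N u p ∸ p + s) ≤ω w → shiftω u p s ⊑ w
witnessAt-steps N p s (fin a) w _ below = below
witnessAt-steps N p s ω ω _ _ = refl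
witnessAt-steps N p s ω (fin y) y<N below
  rewrite ℕP.m+n∸n≡m N p = ⊥-elim (ℕP.<⇒≱ y<N (ℕP.≤-trans (ℕP.m≤m+n N s) below))

lookup-witness : ∀ {m} N (Cω : ωConfig m) (x : Config m) q →
  lookup (witness N Cω x) q ≡ witnessAt N (lookup Cω q) (lookup x q)
lookup-witness N Cω x q = VP.lookup∘tabulate _ q

witness-below : ∀ {m} N (Cω : ωConfig m) (x : Config m) → witness N Cω x ≤ᶜω Cω
witness-below N Cω x = from pointwise⇔ λ q →
  subst (_≤ω lookup Cω q) (≡-sym (lookup-witness N Cω x q)) (witnessAt-below N _ _)

witness-enables : ∀ {m} N (Cω : ωConfig m) (x : Config m) → x ≤ᶜω Cω → x ≤ᶜ witness N Cω x
witness-enables N Cω x x≤Cω = from pointwise⇔ λ q →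
  subst (lookup x q ≤_) (≡-sym (lookup-witness N Cω x q))
    (witnessAt-enables N _ _ (PW.lookup x≤Cω q))

-- "Only if": fire t from the witness of Cᵢ, with N exceeding every finite entry.
steps-from-inductive : ∀ {m n k} (P : ReplicatedSystem m n) (Cs : Vec (ωConfig m) k) →
  Inductive P (Down Cs) →
  ∀ i t → t ∈ T P → pre t ≤ᶜω lookup Cs i → ∃ λ j → StepsBelow (lookup Cs i) t (lookup Cs j)
steps-from-inductive P Cs ind i t t∈T en = j , λ q →
  witnessAt-steps N (lookup (pre t) q) (lookup (post t) q)
    (lookup (lookup Cs i) q) (lookup (lookup Cs j) q) (bound j q)
    (subst (_≤ω lookup (lookup Cs j) q) (fired-entry q) (PW.lookup C′≤Cⱼ q))
  where
  N : ℕ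
  N = suc (sumFin (V.concat Cs))
  bound : ∀ j q → lookup (lookup Cs j) q ≺ N
  bound j q = subst (_≺ N) (VP.lookup-concat Cs j q) (sumFin-bounds (V.concat Cs) (F.combine j q))
  C* : Config _
  C* = witness N (lookup Cs i) (pre t)
  C′ : Config _
  C′ = zipWith _+_ (zipWith _∸_ C* (pre t)) (post t)
  fired-entry : ∀ q → lookup C′ q ≡ witnessAt N (lookup (lookup Cs i) q) (lookup (pre t) q)
                                      ∸ lookup (pre t) q + lookup (post t) q
  fired-entry q = ≡-trans (lookup-fire C* (pre t) (post t) q)
    (≡-cong (λ c → c ∸ lookup (pre t) q + lookup (post t) q) (lookup-witness N (lookup Cs i) (pre t) q))
  landing : Down Cs C′
  landing = ind C* C′ (i , witness-below N (lookup Cs i) (pre t))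
                (t , t∈T , witness-enables N (lookup Cs i) (pre t) en , refl)
  j : Fin _
  j = proj₁ landing
  C′≤Cⱼ : C′ ≤ᶜω lookup Cs j
  C′≤Cⱼ = proj₂ landing

inductive⇔ : ∀ {m n k} (P : ReplicatedSystem m n) (Cs : Vec (ωConfig m) k) →
  Inductive P (Down Cs) ⇔
  (∀ i t → t ∈ T P → pre t ≤ᶜω lookup Cs i → ∃ λ j → StepsBelow (lookup Cs i) t (lookup Cs j))
inductive⇔ P Cs = mk⇔ (steps-from-inductive P Cs) (inductive-from-steps P Cs)

𝟘 : ∀ {V} → LinTerm V
𝟘 {V} = V.replicate V (+ 0)

var : ∀ {V} → Fin V → LinTerm V
var F.zero    = + 1 ∷ 𝟘
var (F.suc a) = + 0 ∷ var a

_⊟_ : ∀ {V} → LinTerm V → LinTerm V → LinTerm V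
_⊟_ = zipWith ℤ._-_

evalLin-𝟘 : ∀ {V} (ρ : Vec ℕ V) → evalLin 𝟘 ρ ≡ + 0
evalLin-𝟘 []      = refl
evalLin-𝟘 (x ∷ ρ) rewrite evalLin-𝟘 ρ | ℤP.*-zeroˡ (+ x) = refl

evalLin-var : ∀ {V} (a : Fin V) (ρ : Vec ℕ V) → evalLin (var a) ρ ≡ + lookup ρ a
evalLin-var F.zero (x ∷ ρ)
  rewrite evalLin-𝟘 ρ | ℤP.*-identityˡ (+ x) = ℤP.+-identityʳ (+ x)
evalLin-var (F.suc a) (x ∷ ρ)
  rewrite evalLin-var a ρ | ℤP.*-zeroˡ (+ x) = ℤP.+-identityˡ (+ lookup ρ a)

evalLin-⊟ : ∀ {V} (u v : LinTerm V) (ρ : Vec ℕ V) →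
  evalLin (u ⊟ v) ρ ≡ evalLin u ρ ℤ.- evalLin v ρ
evalLin-⊟ []      []      []      = refl
evalLin-⊟ (a ∷ u) (b ∷ v) (x ∷ ρ) rewrite evalLin-⊟ u v ρ =
  distrib a b (+ x) (evalLin u ρ) (evalLin v ρ)
  where
  distrib : ∀ a b x e f → (a ℤ.- b) ℤ.* x ℤ.+ (e ℤ.- f) ≡ (a ℤ.* x ℤ.+ e) ℤ.- (b ℤ.* x ℤ.+ f)
  distrib = solve-∀

diff-≤-diff : ∀ i j k l → (i ℤ.- j ℤ.≤ k ℤ.- l) ⇔ (i ℤ.+ l ℤ.≤ j ℤ.+ k)
diff-≤-diff i j k l = mk⇔
  (λ h → subst₂ ℤ._≤_ (add-back i j l) (add-back′ k l j) (ℤP.+-monoˡ-≤ (j ℤ.+ l) h))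
  (λ h → subst₂ ℤ._≤_ (take-away i l j) (take-away′ j k l) (ℤP.+-monoˡ-≤ (- (j ℤ.+ l)) h))
  where
  add-back : ∀ i j l → (i ℤ.- j) ℤ.+ (j ℤ.+ l) ≡ i ℤ.+ l
  add-back = solve-∀
  add-back′ : ∀ k l j → (k ℤ.- l) ℤ.+ (j ℤ.+ l) ≡ j ℤ.+ k
  add-back′ = solve-∀
  take-away : ∀ i l j → (i ℤ.+ l) ℤ.+ (- (j ℤ.+ l)) ≡ i ℤ.- j
  take-away = solve-∀
  take-away′ : ∀ j k l → (j ℤ.+ k) ℤ.+ (- (j ℤ.+ l)) ≡ k ℤ.- l
  take-away′ = solve-∀

atLe : ∀ {V} → LinTerm V → ℕ → LinTerm V → ℕ → QF V
atLe u s v p = leq (u ⊟ v) (+ p ℤ.- + s)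

atLe-sem : ∀ {V} (u : LinTerm V) s v p ρ →
  ⟦ atLe u s v p ⟧qf ρ ⇔ (evalLin u ρ ℤ.+ + s ℤ.≤ evalLin v ρ ℤ.+ + p)
atLe-sem u s v p ρ rewrite evalLin-⊟ u v ρ = diff-≤-diff (evalLin u ρ) (evalLin v ρ) (+ p) (+ s)

atLe-ℕ : ∀ {V} (u : LinTerm V) s v p ρ {x y} → evalLin u ρ ≡ + x → evalLin v ρ ≡ + y →
  ⟦ atLe u s v p ⟧qf ρ ⇔ (x + s ≤ y + p)
atLe-ℕ u s v p ρ {x} {y} u≡x v≡y = ⇔.trans (atLe-sem u s v p ρ)
  (subst₂ (λ e f → (e ℤ.+ + s ℤ.≤ f ℤ.+ + p) ⇔ (x + s ≤ y + p))
    (≡-sym u≡x) (≡-sym v≡y) (mk⇔ ℤP.drop‿+≤+ ℤ.+≤+))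

varDiff : ∀ {V} → Fin V → ℕ → Fin V → ℕ → QF V
varDiff a s b p = atLe (var a) s (var b) p

varDiff-sem : ∀ {V} (a : Fin V) s b p ρ →
  ⟦ varDiff a s b p ⟧qf ρ ⇔ (lookup ρ a + s ≤ lookup ρ b + p)
varDiff-sem a s b p ρ = atLe-ℕ (var a) s (var b) p ρ (evalLin-var a ρ) (evalLin-var b ρ)

varAtMost : ∀ {V} → Fin V → ℕ → QF V
varAtMost a c = atLe (var a) 0 𝟘 c

varAtMost-sem : ∀ {V} (a : Fin V) c ρ → ⟦ varAtMost a c ⟧qf ρ ⇔ (lookup ρ a ≤ c)
varAtMost-sem a c ρ = subst (λ x → ⟦ varAtMost a c ⟧qf ρ ⇔ (x ≤ c)) (ℕP.+-identityʳ (lookup ρ a))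
  (atLe-ℕ (var a) 0 𝟘 c ρ (evalLin-var a ρ) (evalLin-𝟘 ρ))

varAtLeast : ∀ {V} → Fin V → ℕ → QF V
varAtLeast a c = atLe 𝟘 c (var a) 0

varAtLeast-sem : ∀ {V} (a : Fin V) c ρ → ⟦ varAtLeast a c ⟧qf ρ ⇔ (c ≤ lookup ρ a)
varAtLeast-sem a c ρ = subst (λ x → ⟦ varAtLeast a c ⟧qf ρ ⇔ (c ≤ x)) (ℕP.+-identityʳ (lookup ρ a))
  (atLe-ℕ 𝟘 c (var a) 0 ρ (evalLin-𝟘 ρ) (evalLin-var a ρ))

⊤F : ∀ {V} → QF V
⊤F = leq 𝟘 (+ 0)

⊤F-holds : ∀ {V} (ρ : Vec ℕ V) → ⟦ ⊤F ⟧qf ρ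
⊤F-holds ρ rewrite evalLin-𝟘 ρ = ℤP.≤-refl

⋀ : ∀ {V} {A : Set} → List A → (A → QF V) → QF V
⋀ []       φ = ⊤F
⋀ (x ∷ xs) φ = and (φ x) (⋀ xs φ)

⋁ : ∀ {V} {A : Set} → List A → (A → QF V) → QF V
⋁ []       φ = not ⊤F
⋁ (x ∷ xs) φ = or (φ x) (⋁ xs φ)

⋀-sem : ∀ {V} {A : Set} (xs : List A) (φ : A → QF V) ρ →
  ⟦ ⋀ xs φ ⟧qf ρ ⇔ (∀ x → x ∈ xs → ⟦ φ x ⟧qf ρ)
⋀-sem xs φ ρ = mk⇔ (to′ xs) (from′ xs)
  where
  to′ : ∀ xs → ⟦ ⋀ xs φ ⟧qf ρ → ∀ x → x ∈ xs → ⟦ φ x ⟧qf ρ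
  to′ (x ∷ xs) (φx , _)   x (here refl) = φx
  to′ (x ∷ xs) (_  , φxs) y (there y∈xs) = to′ xs φxs y y∈xs
  from′ : ∀ xs → (∀ x → x ∈ xs → ⟦ φ x ⟧qf ρ) → ⟦ ⋀ xs φ ⟧qf ρ
  from′ []       _ = ⊤F-holds ρ
  from′ (x ∷ xs) h = h x (here refl) , from′ xs (λ y y∈xs → h y (there y∈xs))

⋁-sem : ∀ {V} {A : Set} (xs : List A) (φ : A → QF V) ρ →
  ⟦ ⋁ xs φ ⟧qf ρ ⇔ (∃ λ x → x ∈ xs × ⟦ φ x ⟧qf ρ)
⋁-sem xs φ ρ = mk⇔ (to′ xs) (from′ xs)
  where
  to′ : ∀ xs → ⟦ ⋁ xs φ ⟧qf ρ → ∃ λ x → x ∈ xs × ⟦ φ x ⟧qf ρ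
  to′ []       ¬⊤         = ⊥-elim (¬⊤ (⊤F-holds ρ))
  to′ (x ∷ xs) (inj₁ φx)  = x , here refl , φx
  to′ (x ∷ xs) (inj₂ φxs) with to′ xs φxs
  ... | y , y∈xs , φy = y , there y∈xs , φy
  from′ : ∀ xs → (∃ λ x → x ∈ xs × ⟦ φ x ⟧qf ρ) → ⟦ ⋁ xs φ ⟧qf ρ
  from′ (x ∷ xs) (x , here refl , φx)  = inj₁ φx
  from′ (x ∷ xs) (y , there y∈xs , φy) = inj₂ (from′ xs (y , y∈xs , φy))

⋀-cong : ∀ {V} {A : Set} (xs : List A) (φ : A → QF V) ρ {B : A → Set} →
  (∀ x → x ∈ xs → ⟦ φ x ⟧qf ρ ⇔ B x) → ⟦ ⋀ xs φ ⟧qf ρ ⇔ (∀ x → x ∈ xs → B x)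
⋀-cong xs φ ρ e = ⇔.trans (⋀-sem xs φ ρ)
  (mk⇔ (λ h x x∈xs → to (e x x∈xs) (h x x∈xs)) (λ h x x∈xs → from (e x x∈xs) (h x x∈xs)))

⋀ᶠ : ∀ {V j} → (Fin j → QF V) → QF V
⋀ᶠ {j = j} = ⋀ (allFin j)

⋀ᶠ-cong : ∀ {V j} (φ : Fin j → QF V) ρ {B : Fin j → Set} →
  (∀ i → ⟦ φ i ⟧qf ρ ⇔ B i) → ⟦ ⋀ᶠ φ ⟧qf ρ ⇔ (∀ i → B i)
⋀ᶠ-cong {j = j} φ ρ e = ⇔.trans (⋀-cong (allFin j) φ ρ (λ i _ → e i))
  (mk⇔ (λ h i → h i (∈-allFin i)) (λ h i _ → h i))

⋁ᶠ : ∀ {V j} → (Fin j → QF V) → QF V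
⋁ᶠ {j = j} = ⋁ (allFin j)

⋁ᶠ-cong : ∀ {V j} (φ : Fin j → QF V) ρ {B : Fin j → Set} →
  (∀ i → ⟦ φ i ⟧qf ρ ⇔ B i) → ⟦ ⋁ᶠ φ ⟧qf ρ ⇔ (∃ λ i → B i)
⋁ᶠ-cong {j = j} φ ρ e = ⇔.trans (⋁-sem (allFin j) φ ρ)
  (mk⇔ (λ { (i , _ , φi) → i , to (e i) φi }) (λ { (i , Bi) → i , ∈-allFin i , from (e i) Bi }))

decodeω : ℕ → ℕω
decodeω zero    = ω
decodeω (suc a) = fin a

decodeω-encodeω : ∀ u → decodeω (encodeω u) ≡ u
decodeω-encodeω (fin a) = refl
decodeω-encodeω ω       = refl

decodeω-injective : ∀ {e f} → decodeω e ≡ decodeω f → e ≡ f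
decodeω-injective {zero}  {zero}  refl = refl
decodeω-injective {suc a} {suc a} refl = refl

⊑-ω : ∀ u → u ⊑ ω
⊑-ω (fin a) = tt
⊑-ω ω       = refl

∸-shift : ∀ {x p} s y → p ≤ x → (x ∸ p + s ≤ y) ⇔ (x + s ≤ y + p)
∸-shift {x} {p} s y p≤x = mk⇔ to′ from′
  where
  open ℕP.≤-Reasoning
  reorder : x ∸ p + s ≡ x + s ∸ p
  reorder = ≡-sym (ℕP.+-∸-comm s p≤x)
  to′ : x ∸ p + s ≤ y → x + s ≤ y + p
  to′ h = begin
    x + s          ≡⟨ ≡-sym (ℕP.m∸n+n≡m (ℕP.≤-trans p≤x (ℕP.m≤m+n x s))) ⟩
    x + s ∸ p + p  ≡⟨ ≡-cong (_+ p) (≡-sym reorder) ⟩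
    x ∸ p + s + p  ≤⟨ ℕP.+-monoˡ-≤ p h ⟩
    y + p          ∎
  from′ : x + s ≤ y + p → x ∸ p + s ≤ y
  from′ h = begin
    x ∸ p + s      ≡⟨ reorder ⟩
    x + s ∸ p      ≤⟨ ℕP.∸-monoˡ-≤ p h ⟩
    y + p ∸ p      ≡⟨ ℕP.m+n∸n≡m y p ⟩
    y              ∎

atLeast-code : ∀ p e → (e ≤ 0 ⊎ suc p ≤ e) ⇔ (p ≤ω decodeω e)
atLeast-code p zero    = mk⇔ (λ _ → tt) (λ _ → inj₁ z≤n)
atLeast-code p (suc a) = mk⇔ (λ { (inj₁ ()) ; (inj₂ (s≤s p≤a)) → p≤a }) (λ p≤a → inj₂ (s≤s p≤a))

shiftBelow-code : ∀ p s e f → p ≤ω decodeω e →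
  (f ≤ 0 ⊎ (1 ≤ e × e + s ≤ f + p)) ⇔ (shiftω (decodeω e) p s ⊑ decodeω f)
shiftBelow-code p s e       zero    _   = mk⇔ (λ _ → ⊑-ω (shiftω (decodeω e) p s)) (λ _ → inj₁ z≤n)
shiftBelow-code p s zero    (suc y) _   = mk⇔ (λ { (inj₁ ()) ; (inj₂ (() , _)) }) (λ ())
shiftBelow-code p s (suc x) (suc y) p≤x = mk⇔
  (λ { (inj₁ ()) ; (inj₂ (_ , s≤s h)) → from (∸-shift s y p≤x) h })
  (λ h → inj₂ (s≤s z≤n , s≤s (to (∸-shift s y p≤x) h)))

equal-code : ∀ e f → (e + 0 ≤ f + 0 × f + 0 ≤ e + 0) ⇔ (decodeω e ≡ decodeω f)
equal-code e f = mk⇔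
  (λ { (e≤f , f≤e) → ≡-cong decodeω
         (ℕP.≤-antisym (ℕP.+-cancelʳ-≤ 0 e f e≤f) (ℕP.+-cancelʳ-≤ 0 f e f≤e)) })
  (λ e≡f → ℕP.≤-reflexive (≡-cong (_+ 0) (decodeω-injective e≡f)) ,
           ℕP.≤-reflexive (≡-cong (_+ 0) (≡-sym (decodeω-injective e≡f))))

atLeastω : ∀ {V} → ℕ → Fin V → QF V
atLeastω p a = or (varAtMost a 0) (varAtLeast a (suc p))

atLeastω-sem : ∀ {V} p (a : Fin V) ρ → ⟦ atLeastω p a ⟧qf ρ ⇔ (p ≤ω decodeω (lookup ρ a))
atLeastω-sem p a ρ =
  ⇔.trans (varAtMost-sem a 0 ρ ⊎-⇔ varAtLeast-sem a (suc p) ρ) (atLeast-code p (lookup ρ a))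

shiftBelowω : ∀ {V} → ℕ → ℕ → Fin V → Fin V → QF V
shiftBelowω p s a b = or (varAtMost b 0) (and (varAtLeast a 1) (varDiff a s b p))

shiftBelowω-sem : ∀ {V} p s (a b : Fin V) ρ → p ≤ω decodeω (lookup ρ a) →
  ⟦ shiftBelowω p s a b ⟧qf ρ ⇔ (shiftω (decodeω (lookup ρ a)) p s ⊑ decodeω (lookup ρ b))
shiftBelowω-sem p s a b ρ enabled =
  ⇔.trans (varAtMost-sem b 0 ρ ⊎-⇔ (varAtLeast-sem a 1 ρ ×-⇔ varDiff-sem a s b p ρ))
          (shiftBelow-code p s (lookup ρ a) (lookup ρ b) enabled)

equalω : ∀ {V} → Fin V → Fin V → QF V
equalω a b = and (varDiff a 0 b 0) (varDiff b 0 a 0)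

equalω-sem : ∀ {V} (a b : Fin V) ρ →
  ⟦ equalω a b ⟧qf ρ ⇔ (decodeω (lookup ρ a) ≡ decodeω (lookup ρ b))
equalω-sem a b ρ =
  ⇔.trans (varDiff-sem a 0 b 0 ρ ×-⇔ varDiff-sem b 0 a 0 ρ) (equal-code (lookup ρ a) (lookup ρ b))

∃[0]-sem : ∀ {v} (ψ : QF v) ρ → ⟦ ∃[ 0 ] ψ ⟧ ρ ⇔ ⟦ ψ ⟧qf ρ
∃[0]-sem ψ ρ = mk⇔ (λ { ([] , holds) → holds }) (λ holds → [] , holds)

module DeathCertFormula {m n} (P : ReplicatedSystem m n) (U : List (Transition m)) (k : ℕ) where

  -- The variable holding entry q of Cᵢ, as laid out by encode.
  x : Fin k → Fin m → Fin (k * m)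
  x = F.combine

  enabledF : Config m → Fin k → QF (k * m)
  enabledF y i = ⋀ᶠ λ q → atLeastω (lookup y q) (x i q)

  stepsBelowF : Transition m → Fin k → Fin k → QF (k * m)
  stepsBelowF t i j = ⋀ᶠ λ q → shiftBelowω (lookup (pre t) q) (lookup (post t) q) (x i q) (x j q)

  equalF : Fin k → Fin k → QF (k * m)
  equalF i j = ⋀ᶠ λ q → equalω (x i q) (x j q)

  distinctPairF : Fin k → Fin k → QF (k * m)
  distinctPairF i j with i F.≟ j
  ... | yes _ = ⊤F
  ... | no _  = not (equalF i j)

  distinctF : QF (k * m)
  distinctF = ⋀ᶠ λ i → ⋀ᶠ λ j → distinctPairF i j

  disablesF : QF (k * m)
  disablesF = ⋀ᶠ λ i → ⋀ U λ t → not (enabledF (pre t) i)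

  closedClauseF : Fin k → Transition m → QF (k * m)
  closedClauseF i t = or (not (enabledF (pre t) i)) (⋁ᶠ λ j → stepsBelowF t i j)

  closedF : QF (k * m)
  closedF = ⋀ᶠ λ i → ⋀ (T P) λ t → closedClauseF i t

  DeathCert : ExPresburger (k * m)
  DeathCert = ∃[ 0 ] and distinctF (and disablesF closedF)

  module _ (Cs : Vec (ωConfig m) k) where

    ρ : Vec ℕ (k * m)
    ρ = encode Cs

    decode-x : ∀ i q → decodeω (lookup ρ (x i q)) ≡ lookup (lookup Cs i) q
    decode-x i q = begin
      decodeω (lookup (V.concat (V.map (V.map encodeω) Cs)) (F.combine i q))
        ≡⟨ ≡-cong decodeω (VP.lookup-concat (V.map (V.map encodeω) Cs) i q) ⟩
      decodeω (lookup (lookup (V.map (V.map encodeω) Cs) i) q)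
        ≡⟨ ≡-cong (λ C → decodeω (lookup C q)) (VP.lookup-map i (V.map encodeω) Cs) ⟩
      decodeω (lookup (V.map encodeω (lookup Cs i)) q)
        ≡⟨ ≡-cong decodeω (VP.lookup-map q encodeω (lookup Cs i)) ⟩
      decodeω (encodeω (lookup (lookup Cs i) q))
        ≡⟨ decodeω-encodeω (lookup (lookup Cs i) q) ⟩
      lookup (lookup Cs i) q ∎
      where open ≡-Reasoning

    enabledF-sem : ∀ y i → ⟦ enabledF y i ⟧qf ρ ⇔ (y ≤ᶜω lookup Cs i)
    enabledF-sem y i = ⇔.trans (⋀ᶠ-cong _ ρ entry) (⇔.sym pointwise⇔)
      where
      entry : ∀ q → ⟦ atLeastω (lookup y q) (x i q) ⟧qf ρ ⇔ (lookup y q ≤ω lookup (lookup Cs i) q)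
      entry q = subst (λ u → ⟦ atLeastω (lookup y q) (x i q) ⟧qf ρ ⇔ (lookup y q ≤ω u))
        (decode-x i q) (atLeastω-sem (lookup y q) (x i q) ρ)

    stepsBelowF-sem : ∀ t i j → pre t ≤ᶜω lookup Cs i →
      ⟦ stepsBelowF t i j ⟧qf ρ ⇔ StepsBelow (lookup Cs i) t (lookup Cs j)
    stepsBelowF-sem t i j en = ⋀ᶠ-cong _ ρ entry
      where
      entry : ∀ q → ⟦ shiftBelowω (lookup (pre t) q) (lookup (post t) q) (x i q) (x j q) ⟧qf ρ ⇔
        (shiftω (lookup (lookup Cs i) q) (lookup (pre t) q) (lookup (post t) q) ⊑ lookup (lookup Cs j) q)
      entry q =
        subst₂ (λ u w → ⟦ shiftBelowω (lookup (pre t) q) (lookup (post t) q) (x i q) (x j q) ⟧qf ρ ⇔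
                         (shiftω u (lookup (pre t) q) (lookup (post t) q) ⊑ w))
          (decode-x i q) (decode-x j q)
          (shiftBelowω-sem (lookup (pre t) q) (lookup (post t) q) (x i q) (x j q) ρ
            (subst (lookup (pre t) q ≤ω_) (≡-sym (decode-x i q)) (PW.lookup en q)))

    equalF-sem : ∀ i j → ⟦ equalF i j ⟧qf ρ ⇔ (lookup Cs i ≡ lookup Cs j)
    equalF-sem i j = ⇔.trans (⋀ᶠ-cong _ ρ entry) (⇔.trans (⇔.sym pointwise⇔) PW.Pointwise-≡↔≡)
      where
      entry : ∀ q → ⟦ equalω (x i q) (x j q) ⟧qf ρ ⇔ (lookup (lookup Cs i) q ≡ lookup (lookup Cs j) q)
      entry q = subst₂ (λ u w → ⟦ equalω (x i q) (x j q) ⟧qf ρ ⇔ (u ≡ w))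
        (decode-x i q) (decode-x j q) (equalω-sem (x i q) (x j q) ρ)

    distinctPairF-sem : ∀ i j → ⟦ distinctPairF i j ⟧qf ρ ⇔ (lookup Cs i ≡ lookup Cs j → i ≡ j)
    distinctPairF-sem i j with i F.≟ j
    ... | yes i≡j = mk⇔ (λ _ _ → i≡j) (λ _ → ⊤F-holds ρ)
    ... | no i≢j  = ⇔.trans (¬-cong-⇔ (equalF-sem i j))
                            (mk⇔ (λ Cᵢ≢Cⱼ Cᵢ≡Cⱼ → ⊥-elim (Cᵢ≢Cⱼ Cᵢ≡Cⱼ)) (λ h Cᵢ≡Cⱼ → i≢j (h Cᵢ≡Cⱼ)))

    distinctF-sem : ⟦ distinctF ⟧qf ρ ⇔ Distinct Cs
    distinctF-sem = ⋀ᶠ-cong _ ρ λ i → ⋀ᶠ-cong _ ρ λ j → distinctPairF-sem i j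

    disablesF-sem : ⟦ disablesF ⟧qf ρ ⇔ (∀ i t → t ∈ U → ¬ (pre t ≤ᶜω lookup Cs i))
    disablesF-sem = ⋀ᶠ-cong _ ρ λ i → ⋀-cong U _ ρ λ t _ → ¬-cong-⇔ (enabledF-sem (pre t) i)

    -- The clause is "¬ enabled ∨ ⋁ steps"; the disjunct "steps" is only
    -- meaningful when t is enabled, which is decidable.
    closedClauseF-sem : ∀ i t → ⟦ closedClauseF i t ⟧qf ρ ⇔
      (pre t ≤ᶜω lookup Cs i → ∃ λ j → StepsBelow (lookup Cs i) t (lookup Cs j))
    closedClauseF-sem i t = mk⇔ to′ from′
      where
      steps⇔ : pre t ≤ᶜω lookup Cs i →
        ⟦ ⋁ᶠ (λ j → stepsBelowF t i j) ⟧qf ρ ⇔ (∃ λ j → StepsBelow (lookup Cs i) t (lookup Cs j))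
      steps⇔ en = ⋁ᶠ-cong _ ρ λ j → stepsBelowF-sem t i j en
      to′ : ⟦ closedClauseF i t ⟧qf ρ →
        pre t ≤ᶜω lookup Cs i → ∃ λ j → StepsBelow (lookup Cs i) t (lookup Cs j)
      to′ (inj₁ disabled) en = ⊥-elim (disabled (from (enabledF-sem (pre t) i) en))
      to′ (inj₂ steps)    en = to (steps⇔ en) steps
      from′ : (pre t ≤ᶜω lookup Cs i → ∃ λ j → StepsBelow (lookup Cs i) t (lookup Cs j)) →
        ⟦ closedClauseF i t ⟧qf ρ
      from′ h with PW.decidable _≤ω?_ (pre t) (lookup Cs i)
      ... | yes en = inj₂ (from (steps⇔ en) (h en))
      ... | no ¬en = inj₁ (λ e → ¬en (to (enabledF-sem (pre t) i) e))

    closedF-sem : ⟦ closedF ⟧qf ρ ⇔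
      (∀ i t → t ∈ T P → pre t ≤ᶜω lookup Cs i → ∃ λ j → StepsBelow (lookup Cs i) t (lookup Cs j))
    closedF-sem = ⋀ᶠ-cong _ ρ λ i → ⋀-cong (T P) _ ρ λ t _ → closedClauseF-sem i t

    DeathCert-sem : ⟦ DeathCert ⟧ ρ ⇔ (Distinct Cs × IsDeathCertificate P U Cs)
    DeathCert-sem = ⇔.trans (∃[0]-sem _ ρ)
      (distinctF-sem ×-⇔ (⇔.trans disablesF-sem (⇔.sym (disables⇔ Cs U))
                          ×-⇔ ⇔.trans closedF-sem (⇔.sym (inductive⇔ P Cs))))

-- The theorem.  The formula neither needs U ⊆ T nor k ≥ 1.

proposition7 : ∀ {m n} (P : ReplicatedSystem m n) (U : List (Transition m)) →
    All (_∈ T P) U → ∀ (k : ℕ) → 1 ≤ k →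
    Σ (ExPresburger (k * m)) λ DeathCert →
      ∀ (Cs : Vec (ωConfig m) k) →
        ⟦ DeathCert ⟧ (encode Cs) ⇔ (Distinct Cs × IsDeathCertificate P U Cs)
proposition7 P U _ k _ = DeathCert , DeathCert-sem
  where open DeathCertFormula P U k
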